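{- Let $G$ be any finite simple graph and let $G\vee\cdots\vee G$ denote the join of at least two copies of $G$. Then \[\sigma(G\vee\cdots\vee G)=\min\Big\{\sigma(G),\ \Big\lceil\frac{\alpha(G)+1}{2}\Big\rceil\Big\}.\] Consequently, for an indexed family $\{G_n\}_{n=1}^\infty$, the family $\{G_n\vee\cdots\vee G_n\}_{n=1}^\infty$ is sensitive if $\{G_n\}$ is sensitive, and insensitive if $\{G_n\}$ is insensitive.
   Context: $\vee$ is the join (disjoint union plus all edges between the graphs). $\Delta$ is maximum degree, $\alpha$ independence number. For a graph $G=(V,E)$ with at least one edge, $\sigma(G)=\min\{\Delta(G[S]): S\subseteq V,\ |S|>\alpha(G)\}$; for an edgeless graph $\sigma=\infty$. An indexed family of graphs $G_n$ with $\Delta(G_n)\to\infty$ is sensitive if $\sigma(G_n)\to\infty$ and insensitive otherwise. -}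

module Defs where

open import Data.Bool using (Bool; true; false; _∧_; not; if_then_else_)
open import Data.Nat using (ℕ; zero; suc; _+_; _≤_; _<_; _⊔_; _⊓_; _<ᵇ_)
open import Data.Fin using (Fin; splitAt)
open import Data.Fin.Subset using (Subset; _∩_; ∣_∣)
open import Data.Sum using (_⊎_; inj₁; inj₂)
open import Data.Vec using (Vec; []; _∷_; lookup; tabulate)
open import Data.List using (List; []; _∷_; map; foldr; filter; _++_; allFin)
open import Data.Bool.ListAction using (and; or)
open import Data.Product using (_×_; ∃)
open import Relation.Nullary using (¬_)
open import Relation.Binary.PropositionalEquality using (_≡_; refl)

record Graph : Set where
  field
    n      : ℕ
    adj    : Fin n → Fin n → Bool
    sym    : ∀ i j → adj i j ≡ adj j i
    irrefl : ∀ i → adj i i ≡ false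
open Graph public

joinAdj : ∀ {m k} → (Fin m → Fin m → Bool) → (Fin k → Fin k → Bool)
        → Fin m ⊎ Fin k → Fin m ⊎ Fin k → Bool
joinAdj a b (inj₁ i) (inj₁ j) = a i j
joinAdj a b (inj₂ i) (inj₂ j) = b i j
joinAdj a b (inj₁ i) (inj₂ j) = true
joinAdj a b (inj₂ i) (inj₁ j) = true

joinAdj-sym : ∀ {m k} (a : Fin m → Fin m → Bool) (b : Fin k → Fin k → Bool)
  → (∀ i j → a i j ≡ a j i) → (∀ i j → b i j ≡ b j i)
  → ∀ x y → joinAdj a b x y ≡ joinAdj a b y x
joinAdj-sym a b sa sb (inj₁ i) (inj₁ j) = sa i j
joinAdj-sym a b sa sb (inj₂ i) (inj₂ j) = sb i j
joinAdj-sym a b sa sb (inj₁ i) (inj₂ j) = refl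
joinAdj-sym a b sa sb (inj₂ i) (inj₁ j) = refl

joinAdj-irr : ∀ {m k} (a : Fin m → Fin m → Bool) (b : Fin k → Fin k → Bool)
  → (∀ i → a i i ≡ false) → (∀ i → b i i ≡ false)
  → ∀ x → joinAdj a b x x ≡ false
joinAdj-irr a b ia ib (inj₁ i) = ia i
joinAdj-irr a b ia ib (inj₂ i) = ib i

_∨G_ : Graph → Graph → Graph
G ∨G H = record
  { n      = n G + n H
  ; adj    = λ i j → joinAdj (adj G) (adj H) (splitAt (n G) i) (splitAt (n G) j)
  ; sym    = λ i j → joinAdj-sym (adj G) (adj H) (sym G) (sym H)
                       (splitAt (n G) i) (splitAt (n G) j)
  ; irrefl = λ i → joinAdj-irr (adj G) (adj H) (irrefl G) (irrefl H) (splitAt (n G) i)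
  }

-- joinCopies G k = G ∨ G ∨ ⋯ ∨ G with (k + 1) copies of G.
joinCopies : Graph → ℕ → Graph
joinCopies G zero    = G
joinCopies G (suc k) = G ∨G joinCopies G k

data ℕ∞ : Set where
  fin : ℕ → ℕ∞
  ∞   : ℕ∞

min∞ : ℕ∞ → ℕ∞ → ℕ∞
min∞ (fin a) (fin b) = fin (a ⊓ b)
min∞ (fin a) ∞       = fin a
min∞ ∞       y       = y

_≤∞_ : ℕ → ℕ∞ → Set
M ≤∞ fin a = M ≤ a
M ≤∞ ∞     = Data.Unit.⊤
  where import Data.Unit

allSubsets : ∀ m → List (Subset m)
allSubsets zero    = [] ∷ []
allSubsets (suc m) = map (true ∷_) (allSubsets m) ++ map (false ∷_) (allSubsets m)

maxList : List ℕ → ℕ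
maxList = foldr _⊔_ 0

nbhd : (G : Graph) → Fin (n G) → Subset (n G)
nbhd G v = tabulate (adj G v)

ΔInd : (G : Graph) → Subset (n G) → ℕ
ΔInd G S = maxList (map (λ v → if lookup S v then ∣ S ∩ nbhd G v ∣ else 0) (allFin (n G)))

Δ : Graph → ℕ
Δ G = maxList (map (λ v → ∣ nbhd G v ∣) (allFin (n G)))

independent : (G : Graph) → Subset (n G) → Bool
independent G S =
  and (map (λ u → and (map (λ v → not (lookup S u ∧ lookup S v ∧ adj G u v))
                           (allFin (n G))))
           (allFin (n G)))

α : Graph → ℕ
α G = maxList (map ∣_∣ (filter (λ S → Data.Bool.T? (independent G S)) (allSubsets (n G))))
  where import Data.Bool

hasEdge : Graph → Bool
hasEdge G = or (map (λ u → or (map (λ v → adj G u v) (allFin (n G)))) (allFin (n G)))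

minList∞ : List ℕ → ℕ∞
minList∞ []       = ∞
minList∞ (x ∷ xs) = min∞ (fin x) (minList∞ xs)

σ : Graph → ℕ∞
σ G = if hasEdge G
      then minList∞ (map (ΔInd G)
             (filter (λ S → Data.Bool.T? (α G <ᵇ ∣ S ∣)) (allSubsets (n G))))
      else ∞
  where import Data.Bool

Family : Set
Family = ℕ → Graph

ΔToInfinity : Family → Set
ΔToInfinity F = ∀ M → ∃ λ N → ∀ m → N ≤ m → M ≤ Δ (F m)

σToInfinity : Family → Set
σToInfinity F = ∀ M → ∃ λ N → ∀ m → N ≤ m → M ≤∞ σ (F m)

Sensitive : Family → Set
Sensitive F = ΔToInfinity F × σToInfinity F

Insensitive : Family → Set
Insensitive F = ΔToInfinity F × ¬ σToInfinity F

-- σ(G) is determined by its lower bounds: M ≤ σ(G) iff every set of more than α(G) vertices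
-- induces a vertex of degree at least M. An independent set of G ∨ H lies on one side, so the
-- join of copies of G still has independence number α = α(G). A set S of more than α vertices of
-- G ∨ H either lies on one side, where the bound for that side applies, or meets both sides A and
-- B; then every vertex of A is adjacent to all of B and vice versa, so S induces a vertex of degree
-- at least max(|A|, |B|) ≥ ⌈(α + 1)/2⌉. Conversely, a set witnessing σ(G) sits in one copy, and
-- α + 1 independent vertices split as ⌈(α + 1)/2⌉ + ⌊(α + 1)/2⌋ between two copies induce maximum
-- degree ⌈(α + 1)/2⌉. For sensitivity, note that Δ does not drop under joins and that, when G has
-- an edge, any α + 1 vertices witness σ(G) ≤ α(G).

module Submission where

open import Defs hiding (sym)
open import Data.Bool using (Bool; true; false; T; T?; not; _∧_; if_then_else_)
open import Data.Bool.ListAction using (all)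
open import Data.Bool.Properties using (T-≡; T-not-≡)
open import Data.Empty using (⊥-elim)
open import Data.Fin using (Fin; zero; suc; _↑ˡ_; _↑ʳ_; splitAt; fromℕ<)
open import Data.Fin.Properties using (splitAt-↑ˡ; splitAt-↑ʳ; splitAt⁻¹-↑ˡ; splitAt⁻¹-↑ʳ)
open import Data.Fin.Subset
  using (Subset; inside; outside; _∈_; _∉_; _⊆_; _∩_; ∣_∣; ⊥; ⊤; ⁅_⁆; Empty)
open import Data.Fin.Subset.Properties
  using (∉⊥; ⊥⊆; ∈⊤; ∣⊥∣≡0; ∣⊤∣≡n; ∣p∣≤n; ∣p∣≡n⇒p≡⊤; out⊆; s⊆s; nonempty?; Empty-unique;
         p⊂q⇒∣p∣<∣q∣; p∩q⊆p; x∈p∩q⁻; ∩-identityʳ; x∈⁅y⁆⇒x≡y; ∣⁅x⁆∣≡1)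
open import Data.List using (List; []; _∷_; map; filter; allFin)
open import Data.List.Membership.Propositional using (lose) renaming (_∈_ to _∈ˡ_)
open import Data.List.Membership.Propositional.Properties
  using (∈-allFin; ∈-filter⁺; ∈-filter⁻; ∈-map⁺; ∈-map⁻; ∈-++⁺ˡ; ∈-++⁺ʳ; foldr-selective)
import Data.List.Relation.Unary.All as All
open import Data.List.Relation.Unary.All.Properties using (all⁺; all⁻)
open import Data.List.Relation.Unary.Any using (here; there)
open import Data.List.Relation.Unary.Any.Properties using (any⁺)
open import Data.Nat
open import Data.Nat.Properties
open import Data.Product using (_×_; _,_; ∃; ∃₂; proj₁; proj₂; uncurry)
open import Data.Sum using (_⊎_; inj₁; inj₂)
open import Data.Unit using (tt)
open import Data.Vec using (Vec; []; _∷_; _[_]=_; here; there; lookup; tabulate)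
  renaming (_++_ to _++ᵛ_)
open import Data.Vec.Properties
  using ([]=⇒lookup; lookup⇒[]=; lookup∘tabulate; tabulate-cong; zipWith-++)
open import Function using (_∘_)
open import Function.Bundles using (_⇔_; mk⇔; Equivalence)
open import Relation.Nullary using (¬_; yes; no; contradiction)
open import Relation.Binary.PropositionalEquality
  using (_≡_; _≢_; refl; sym; trans; cong; cong₂; subst; subst₂; module ≡-Reasoning)

open Equivalence using (to; from)

≤-maxList : ∀ {A : Set} (f : A → ℕ) {x xs} → x ∈ˡ xs → f x ≤ maxList (map f xs)
≤-maxList f {xs = y ∷ xs} (here refl)  = m≤m⊔n (f y) _
≤-maxList f {xs = y ∷ xs} (there x∈xs) = ≤-trans (≤-maxList f x∈xs) (m≤n⊔m (f y) _)

maxList-≤ : ∀ {A : Set} (f : A → ℕ) xs {b} → (∀ {x} → x ∈ˡ xs → f x ≤ b) → maxList (map f xs) ≤ b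
maxList-≤ f []       _ = z≤n
maxList-≤ f (y ∷ xs) h = ⊔-lub (h (here refl)) (maxList-≤ f xs (h ∘ there))

maxList-attained : ∀ {A : Set} (f : A → ℕ) xs →
  maxList (map f xs) ≡ 0 ⊎ ∃ λ x → x ∈ˡ xs × f x ≡ maxList (map f xs)
maxList-attained f xs with foldr-selective ⊔-sel 0 (map f xs)
... | inj₁ max≡0 = inj₁ max≡0
... | inj₂ max∈  with ∈-map⁻ f max∈
...   | x , x∈xs , max≡fx = inj₂ (x , x∈xs , sym max≡fx)

≤∞-min∞ : ∀ {M} x y → M ≤∞ min∞ x y ⇔ (M ≤∞ x × M ≤∞ y)
≤∞-min∞ (fin a) (fin b) =
  mk⇔ (λ M≤a⊓b → ≤-trans M≤a⊓b (m⊓n≤m a b) , ≤-trans M≤a⊓b (m⊓n≤n a b)) (uncurry ⊓-glb)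
≤∞-min∞ (fin a) ∞       = mk⇔ (_, tt) proj₁
≤∞-min∞ ∞       y       = mk⇔ (tt ,_) proj₂

≤∞-minList∞ : ∀ {A : Set} (f : A → ℕ) xs {M} →
  M ≤∞ minList∞ (map f xs) ⇔ (∀ {x} → x ∈ˡ xs → M ≤ f x)
≤∞-minList∞ f []       = mk⇔ (λ _ ()) (λ _ → tt)
≤∞-minList∞ f (y ∷ xs) = mk⇔
  (λ M≤min → let M≤fy , M≤rest = to (≤∞-min∞ (fin (f y)) _) M≤min in
     λ { (here refl) → M≤fy ; (there x∈xs) → to (≤∞-minList∞ f xs) M≤rest x∈xs })
  (λ M≤f → from (≤∞-min∞ (fin (f y)) _)
     (M≤f (here refl) , from (≤∞-minList∞ f xs) (λ x∈xs → M≤f (there x∈xs))))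

≤∞-ext : ∀ x y → (∀ M → M ≤∞ x ⇔ M ≤∞ y) → x ≡ y
≤∞-ext (fin a) (fin b) h = cong fin (≤-antisym (to (h a) ≤-refl) (from (h b) ≤-refl))
≤∞-ext (fin a) ∞       h = ⊥-elim (1+n≰n (from (h (suc a)) tt))
≤∞-ext ∞       (fin b) h = ⊥-elim (1+n≰n (to (h (suc b)) tt))
≤∞-ext ∞       ∞       h = refl

⌊m+m/2⌋≡m : ∀ m → ⌊ m + m /2⌋ ≡ m
⌊m+m/2⌋≡m zero    = refl
⌊m+m/2⌋≡m (suc m) rewrite +-suc m m = cong suc (⌊m+m/2⌋≡m m)

⌈m+m/2⌉≡m : ∀ m → ⌈ m + m /2⌉ ≡ m
⌈m+m/2⌉≡m zero    = refl
⌈m+m/2⌉≡m (suc m) rewrite +-suc m m = cong suc (⌈m+m/2⌉≡m m)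

n≤m+m⇒⌈n/2⌉≤m : ∀ {m n} → n ≤ m + m → ⌈ n /2⌉ ≤ m
n≤m+m⇒⌈n/2⌉≤m {m} n≤m+m = subst (_ ≤_) (⌈m+m/2⌉≡m m) (⌈n/2⌉-mono n≤m+m)

m+m≤n⇒m≤⌊n/2⌋ : ∀ {m n} → m + m ≤ n → m ≤ ⌊ n /2⌋
m+m≤n⇒m≤⌊n/2⌋ {m} m+m≤n = subst (_≤ _) (⌊m+m/2⌋≡m m) (⌊n/2⌋-mono m+m≤n)

[]=-++⁺ˡ : ∀ {A : Set} {m k} {xs : Vec A m} {ys : Vec A k} {i x} →
           xs [ i ]= x → (xs ++ᵛ ys) [ i ↑ˡ k ]= x
[]=-++⁺ˡ here         = here
[]=-++⁺ˡ (there xs[i]) = there ([]=-++⁺ˡ xs[i])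

[]=-++⁻ˡ : ∀ {A : Set} {m k} (xs : Vec A m) {ys : Vec A k} {i x} →
           (xs ++ᵛ ys) [ i ↑ˡ k ]= x → xs [ i ]= x
[]=-++⁻ˡ (_ ∷ xs) {i = zero}  here          = here
[]=-++⁻ˡ (_ ∷ xs) {i = suc i} (there ys[i]) = there ([]=-++⁻ˡ xs ys[i])

[]=-++⁺ʳ : ∀ {A : Set} {m k} (xs : Vec A m) {ys : Vec A k} {j x} →
           ys [ j ]= x → (xs ++ᵛ ys) [ m ↑ʳ j ]= x
[]=-++⁺ʳ []       ys[j] = ys[j]
[]=-++⁺ʳ (_ ∷ xs) ys[j] = there ([]=-++⁺ʳ xs ys[j])

[]=-++⁻ʳ : ∀ {A : Set} {m k} (xs : Vec A m) {ys : Vec A k} {j x} →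
           (xs ++ᵛ ys) [ m ↑ʳ j ]= x → ys [ j ]= x
[]=-++⁻ʳ []       ys[j]         = ys[j]
[]=-++⁻ʳ (_ ∷ xs) (there ys[j]) = []=-++⁻ʳ xs ys[j]

tabulate-++ : ∀ {A : Set} m {k} (f : Fin (m + k) → A) →
              tabulate f ≡ tabulate (f ∘ (_↑ˡ k)) ++ᵛ tabulate (f ∘ (m ↑ʳ_))
tabulate-++ zero    f = refl
tabulate-++ (suc m) f = cong (f zero ∷_) (tabulate-++ m (f ∘ suc))

tabulate-true≡⊤ : ∀ k → tabulate {n = k} (λ _ → true) ≡ ⊤
tabulate-true≡⊤ zero    = refl
tabulate-true≡⊤ (suc k) = cong (true ∷_) (tabulate-true≡⊤ k)

∣p++q∣≡∣p∣+∣q∣ : ∀ {m k} (p : Subset m) (q : Subset k) → ∣ p ++ᵛ q ∣ ≡ ∣ p ∣ + ∣ q ∣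
∣p++q∣≡∣p∣+∣q∣ []            q = refl
∣p++q∣≡∣p∣+∣q∣ (inside  ∷ p) q = cong suc (∣p++q∣≡∣p∣+∣q∣ p q)
∣p++q∣≡∣p∣+∣q∣ (outside ∷ p) q = ∣p++q∣≡∣p∣+∣q∣ p q

Empty⇒∣p∣≡0 : ∀ {m} {p : Subset m} → Empty p → ∣ p ∣ ≡ 0
Empty⇒∣p∣≡0 {m} p≡∅ = trans (cong ∣_∣ (Empty-unique p≡∅)) (∣⊥∣≡0 m)

∣p++q∣≡∣p∣ : ∀ {m k} (p : Subset m) {q : Subset k} → Empty q → ∣ p ++ᵛ q ∣ ≡ ∣ p ∣
∣p++q∣≡∣p∣ p {q} q≡∅ =
  trans (∣p++q∣≡∣p∣+∣q∣ p q) (trans (cong (∣ p ∣ +_) (Empty⇒∣p∣≡0 q≡∅)) (+-identityʳ _))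

∣p++q∣≡∣q∣ : ∀ {m k} {p : Subset m} (q : Subset k) → Empty p → ∣ p ++ᵛ q ∣ ≡ ∣ q ∣
∣p++q∣≡∣q∣ {p = p} q p≡∅ = trans (∣p++q∣≡∣p∣+∣q∣ p q) (cong (_+ ∣ q ∣) (Empty⇒∣p∣≡0 p≡∅))

Empty⊥ : ∀ {m} → Empty (⊥ {m})
Empty⊥ (_ , x∈⊥) = ∉⊥ x∈⊥

⊆-ofSize : ∀ {m} (p : Subset m) {q} → q ≤ ∣ p ∣ → ∃ λ r → r ⊆ p × ∣ r ∣ ≡ q
⊆-ofSize []            z≤n = [] , (λ ()) , refl
⊆-ofSize (outside ∷ p) q≤p with ⊆-ofSize p q≤p
... | r , r⊆p , ∣r∣≡q = outside ∷ r , out⊆ r⊆p , ∣r∣≡q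
⊆-ofSize {suc m} (inside ∷ p) {zero} _ = ⊥ , ⊥⊆ , ∣⊥∣≡0 (suc m)
⊆-ofSize (inside ∷ p) {suc q} (s≤s q≤p) with ⊆-ofSize p q≤p
... | r , r⊆p , ∣r∣≡q = inside ∷ r , s⊆s r⊆p , cong suc ∣r∣≡q

allSubsets-complete : ∀ {m} (p : Subset m) → p ∈ˡ allSubsets m
allSubsets-complete []            = here refl
allSubsets-complete {suc m} (inside ∷ p)  = ∈-++⁺ˡ (∈-map⁺ (inside ∷_) (allSubsets-complete p))
allSubsets-complete {suc m} (outside ∷ p) =
  ∈-++⁺ʳ (map (inside ∷_) (allSubsets m)) (∈-map⁺ (outside ∷_) (allSubsets-complete p))

deg : (G : Graph) → Subset (n G) → Fin (n G) → ℕ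
deg G S v = ∣ S ∩ nbhd G v ∣

Independent : (G : Graph) → Subset (n G) → Set
Independent G S = ∀ {u v} → u ∈ S → v ∈ S → adj G u v ≡ false

infix 4 _≤σ_
_≤σ_ : ℕ → Graph → Set
M ≤σ G = ∀ S → α G < ∣ S ∣ → M ≤ ΔInd G S

module _ (G : Graph) where

  ∈-nbhd⁻ : ∀ {v w} → w ∈ nbhd G v → adj G v w ≡ true
  ∈-nbhd⁻ {v} {w} w∈ = trans (sym (lookup∘tabulate (adj G v) w)) ([]=⇒lookup w∈)

  ∉-nbhd : ∀ {v w} → adj G v w ≡ false → w ∉ nbhd G v
  ∉-nbhd v≁w w∈ = contradiction (trans (sym v≁w) (∈-nbhd⁻ w∈)) λ ()

  deg≤ΔInd : ∀ {S v} → v ∈ S → deg G S v ≤ ΔInd G S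
  deg≤ΔInd {S} {v} v∈S =
    subst (_≤ ΔInd G S) (cong (λ b → if b then deg G S v else 0) ([]=⇒lookup v∈S))
          (≤-maxList (λ v → if lookup S v then deg G S v else 0) (∈-allFin v))

  ΔInd≤ : ∀ S {b} → (∀ {v} → v ∈ S → deg G S v ≤ b) → ΔInd G S ≤ b
  ΔInd≤ S {b} h = maxList-≤ _ (allFin (n G)) λ {v} _ → degOrZero≤ v
    where
    degOrZero≤ : ∀ v → (if lookup S v then deg G S v else 0) ≤ b
    degOrZero≤ v with lookup S v in eq
    ... | true  = h (lookup⇒[]= v S eq)
    ... | false = z≤n

  deg<∣S∣ : ∀ {S v} → v ∈ S → deg G S v < ∣ S ∣
  deg<∣S∣ {S} {v} v∈S = p⊂q⇒∣p∣<∣q∣ (p∩q⊆p S (nbhd G v) , v , v∈S , v∉S∩N)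
    where
    v∉S∩N : v ∉ S ∩ nbhd G v
    v∉S∩N v∈ = ∉-nbhd (irrefl G v) (proj₂ (x∈p∩q⁻ S (nbhd G v) v∈))

  Independent⇒deg≡0 : ∀ {S v} → Independent G S → v ∈ S → deg G S v ≡ 0
  Independent⇒deg≡0 {S} {v} ind v∈S = Empty⇒∣p∣≡0 noNeighbour
    where
    noNeighbour : Empty (S ∩ nbhd G v)
    noNeighbour (w , w∈) = let w∈S , w∈N = x∈p∩q⁻ S (nbhd G v) w∈ in
      contradiction (trans (sym (ind v∈S w∈S)) (∈-nbhd⁻ w∈N)) λ ()

  Independent-⊥ : Independent G ⊥
  Independent-⊥ u∈⊥ _ = contradiction u∈⊥ ∉⊥

  ⊆-Independent : ∀ {S I} → S ⊆ I → Independent G I → Independent G S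
  ⊆-Independent S⊆I indI u∈S v∈S = indI (S⊆I u∈S) (S⊆I v∈S)

  Independent⇔independent : ∀ {S} → Independent G S ⇔ T (independent G S)
  Independent⇔independent {S} = mk⇔ complete sound
    where
    entry : Fin (n G) → Fin (n G) → Bool
    entry u v = not (lookup S u ∧ lookup S v ∧ adj G u v)
    row : Fin (n G) → Bool
    row u = all (entry u) (allFin (n G))
    entry-true : Independent G S → ∀ u v → T (entry u v)
    entry-true ind u v with lookup S u in u∈S | lookup S v in v∈S
    ... | false | _     = tt
    ... | true  | false = tt
    ... | true  | true  = from T-not-≡ (ind (lookup⇒[]= u S u∈S) (lookup⇒[]= v S v∈S))
    complete : Independent G S → T (independent G S)
    complete ind = all⁻ row {xs = allFin (n G)} (All.tabulate λ {u} _ →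
                     all⁻ (entry u) {xs = allFin (n G)} (All.tabulate λ {v} _ → entry-true ind u v))
    entry-false : ∀ {a b c} → T (not (a ∧ b ∧ c)) → a ≡ true → b ≡ true → c ≡ false
    entry-false t refl refl = to T-not-≡ t
    sound : T (independent G S) → Independent G S
    sound ind {u} {v} u∈S v∈S =
      let rowᵤ = All.lookup (all⁺ row _ ind) (∈-allFin u) in
      entry-false (All.lookup (all⁺ (entry u) _ rowᵤ) (∈-allFin v)) ([]=⇒lookup u∈S) ([]=⇒lookup v∈S)

  private
    independentSets : List (Subset (n G))
    independentSets = filter (λ S → T? (independent G S)) (allSubsets (n G))

    ∈-independentSets : ∀ {S} → S ∈ˡ independentSets ⇔ Independent G S
    ∈-independentSets {S} = mk⇔ sound complete
      where
      sound : S ∈ˡ independentSets → Independent G S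
      sound S∈ = from Independent⇔independent (proj₂ (∈-filter⁻ _ {xs = allSubsets (n G)} S∈))
      complete : Independent G S → S ∈ˡ independentSets
      complete ind = ∈-filter⁺ _ (allSubsets-complete S) (to Independent⇔independent ind)

  ∣S∣≤α : ∀ {S} → Independent G S → ∣ S ∣ ≤ α G
  ∣S∣≤α ind = ≤-maxList ∣_∣ (from ∈-independentSets ind)

  α≤ : ∀ {b} → (∀ {S} → Independent G S → ∣ S ∣ ≤ b) → α G ≤ b
  α≤ h = maxList-≤ ∣_∣ independentSets (h ∘ to ∈-independentSets)

  α-attained : ∃ λ S → Independent G S × ∣ S ∣ ≡ α G
  α-attained with maxList-attained ∣_∣ independentSets
  ... | inj₁ α≡0 = ⊥ , Independent-⊥ , trans (∣⊥∣≡0 (n G)) (sym α≡0)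
  ... | inj₂ (S , S∈ , ∣S∣≡α) = S , to ∈-independentSets S∈ , ∣S∣≡α

  1≤α : 0 < n G → 1 ≤ α G
  1≤α 0<n = subst (_≤ α G) (∣⁅x⁆∣≡1 v) (∣S∣≤α singleton)
    where
    v : Fin (n G)
    v = fromℕ< 0<n
    singleton : Independent G ⁅ v ⁆
    singleton u∈ w∈ rewrite x∈⁅y⁆⇒x≡y v u∈ | x∈⁅y⁆⇒x≡y v w∈ = irrefl G v

  edge⇒hasEdge : ∀ {u v} → adj G u v ≡ true → T (hasEdge G)
  edge⇒hasEdge {u} {v} u∼v =
    any⁺ _ (lose (∈-allFin u) (any⁺ (adj G u) (lose (∈-allFin v) (from T-≡ u∼v))))

  private
    bigSubsets : List (Subset (n G))
    bigSubsets = filter (λ S → T? (α G <ᵇ ∣ S ∣)) (allSubsets (n G))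

  -- For an edgeless graph both sides hold: σ is ∞, and no vertex set exceeds α.
  ≤∞σ⇔≤σ : ∀ {M} → M ≤∞ σ G ⇔ M ≤σ G
  ≤∞σ⇔≤σ {M} = byEdge (hasEdge G) refl
    where
    byEdge : ∀ b → hasEdge G ≡ b →
             M ≤∞ (if b then minList∞ (map (ΔInd G) bigSubsets) else ∞) ⇔ M ≤σ G
    byEdge true _ = mk⇔
      (λ M≤min S α<S → to (≤∞-minList∞ (ΔInd G) bigSubsets) M≤min
                          (∈-filter⁺ _ (allSubsets-complete S) (<⇒<ᵇ α<S)))
      (λ M≤σG → from (≤∞-minList∞ (ΔInd G) bigSubsets) λ {S} S∈ →
                  M≤σG S (<ᵇ⇒< _ _ (proj₂ (∈-filter⁻ _ {xs = allSubsets (n G)} S∈))))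
    byEdge false noEdge =
      mk⇔ (λ _ S α<S → contradiction (∣S∣≤α {S} (λ _ _ → edgeless)) (<⇒≱ α<S)) (λ _ → tt)
      where
      edgeless : ∀ {u v} → adj G u v ≡ false
      edgeless {u} {v} with adj G u v in u∼v
      ... | false = refl
      ... | true  = contradiction (subst T noEdge (edge⇒hasEdge u∼v)) λ ()

  1≤Δ⇒edge : 1 ≤ Δ G → ∃₂ λ u v → adj G u v ≡ true
  1≤Δ⇒edge 1≤Δ with maxList-attained (λ v → ∣ nbhd G v ∣) (allFin (n G))
  ... | inj₁ Δ≡0 = contradiction (subst (1 ≤_) Δ≡0 1≤Δ) λ ()
  ... | inj₂ (u , _ , ∣N∣≡Δ) with nonempty? (nbhd G u)
  ...   | yes (v , v∈N) = u , v , ∈-nbhd⁻ v∈N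
  ...   | no  N≡∅       =
    contradiction (subst (1 ≤_) (trans (sym ∣N∣≡Δ) (Empty⇒∣p∣≡0 N≡∅)) 1≤Δ) λ ()

  α<n : 1 ≤ Δ G → α G < n G
  α<n 1≤Δ with 1≤Δ⇒edge 1≤Δ | α-attained
  ... | u , v , u∼v | I , ind , ∣I∣≡α = subst (_< n G) ∣I∣≡α (≤∧≢⇒< (∣p∣≤n I) I≢V)
    where
    I≢V : ∣ I ∣ ≢ n G
    I≢V ∣I∣≡n = let I≡V = ∣p∣≡n⇒p≡⊤ ∣I∣≡n
                    u∈I = subst (u ∈_) (sym I≡V) ∈⊤
                    v∈I = subst (v ∈_) (sym I≡V) ∈⊤
                in contradiction (trans (sym (ind u∈I v∈I)) u∼v) λ ()

  ≤σ⇒≤α : ∀ {M} → 1 ≤ Δ G → M ≤σ G → M ≤ α G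
  ≤σ⇒≤α 1≤Δ M≤σG with ⊆-ofSize ⊤ (subst (suc (α G) ≤_) (sym (∣⊤∣≡n (n G))) (α<n 1≤Δ))
  ... | S , _ , ∣S∣≡1+α =
    ≤-trans (M≤σG S (subst (α G <_) (sym ∣S∣≡1+α) ≤-refl))
            (ΔInd≤ S λ {v} v∈S → ≤-pred (subst (deg G S v <_) ∣S∣≡1+α (deg<∣S∣ v∈S)))

data JoinVertex (m k : ℕ) : Fin (m + k) → Set where
  left  : (i : Fin m) → JoinVertex m k (i ↑ˡ k)
  right : (j : Fin k) → JoinVertex m k (m ↑ʳ j)

joinVertex : ∀ m k (v : Fin (m + k)) → JoinVertex m k v
joinVertex m k v with splitAt m v in eq
... | inj₁ i = subst (JoinVertex m k) (splitAt⁻¹-↑ˡ eq) (left i)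
... | inj₂ j = subst (JoinVertex m k) (splitAt⁻¹-↑ʳ eq) (right j)

module _ (G H : Graph) where

  private
    m = n G
    k = n H
    G∨H = G ∨G H

  adj-↑ˡ-↑ˡ : ∀ i i' → adj G∨H (i ↑ˡ k) (i' ↑ˡ k) ≡ adj G i i'
  adj-↑ˡ-↑ˡ i i' rewrite splitAt-↑ˡ m i k | splitAt-↑ˡ m i' k = refl

  adj-↑ʳ-↑ʳ : ∀ j j' → adj G∨H (m ↑ʳ j) (m ↑ʳ j') ≡ adj H j j'
  adj-↑ʳ-↑ʳ j j' rewrite splitAt-↑ʳ m k j | splitAt-↑ʳ m k j' = refl

  adj-↑ˡ-↑ʳ : ∀ i j → adj G∨H (i ↑ˡ k) (m ↑ʳ j) ≡ true
  adj-↑ˡ-↑ʳ i j rewrite splitAt-↑ˡ m i k | splitAt-↑ʳ m k j = refl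

  adj-↑ʳ-↑ˡ : ∀ j i → adj G∨H (m ↑ʳ j) (i ↑ˡ k) ≡ true
  adj-↑ʳ-↑ˡ j i rewrite splitAt-↑ˡ m i k | splitAt-↑ʳ m k j = refl

  nbhd-↑ˡ : ∀ i → nbhd G∨H (i ↑ˡ k) ≡ nbhd G i ++ᵛ ⊤
  nbhd-↑ˡ i = trans (tabulate-++ m (adj G∨H (i ↑ˡ k)))
    (cong₂ _++ᵛ_ (tabulate-cong (adj-↑ˡ-↑ˡ i))
                 (trans (tabulate-cong (adj-↑ˡ-↑ʳ i)) (tabulate-true≡⊤ k)))

  nbhd-↑ʳ : ∀ j → nbhd G∨H (m ↑ʳ j) ≡ ⊤ ++ᵛ nbhd H j
  nbhd-↑ʳ j = trans (tabulate-++ m (adj G∨H (m ↑ʳ j)))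
    (cong₂ _++ᵛ_ (trans (tabulate-cong (adj-↑ʳ-↑ˡ j)) (tabulate-true≡⊤ m))
                 (tabulate-cong (adj-↑ʳ-↑ʳ j)))

  deg-↑ˡ : ∀ (A : Subset m) (B : Subset k) i → deg G∨H (A ++ᵛ B) (i ↑ˡ k) ≡ deg G A i + ∣ B ∣
  deg-↑ˡ A B i = begin
    ∣ (A ++ᵛ B) ∩ nbhd G∨H (i ↑ˡ k) ∣  ≡⟨ cong (λ N → ∣ (A ++ᵛ B) ∩ N ∣) (nbhd-↑ˡ i) ⟩
    ∣ (A ++ᵛ B) ∩ (nbhd G i ++ᵛ ⊤) ∣   ≡⟨ cong ∣_∣ (zipWith-++ _∧_ A B (nbhd G i) ⊤) ⟩
    ∣ (A ∩ nbhd G i) ++ᵛ (B ∩ ⊤) ∣     ≡⟨ ∣p++q∣≡∣p∣+∣q∣ (A ∩ nbhd G i) (B ∩ ⊤) ⟩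
    deg G A i + ∣ B ∩ ⊤ ∣              ≡⟨ cong (λ X → deg G A i + ∣ X ∣) (∩-identityʳ B) ⟩
    deg G A i + ∣ B ∣                  ∎
    where open ≡-Reasoning

  deg-↑ʳ : ∀ (A : Subset m) (B : Subset k) j → deg G∨H (A ++ᵛ B) (m ↑ʳ j) ≡ ∣ A ∣ + deg H B j
  deg-↑ʳ A B j = begin
    ∣ (A ++ᵛ B) ∩ nbhd G∨H (m ↑ʳ j) ∣  ≡⟨ cong (λ N → ∣ (A ++ᵛ B) ∩ N ∣) (nbhd-↑ʳ j) ⟩
    ∣ (A ++ᵛ B) ∩ (⊤ ++ᵛ nbhd H j) ∣   ≡⟨ cong ∣_∣ (zipWith-++ _∧_ A B ⊤ (nbhd H j)) ⟩
    ∣ (A ∩ ⊤) ++ᵛ (B ∩ nbhd H j) ∣     ≡⟨ ∣p++q∣≡∣p∣+∣q∣ (A ∩ ⊤) (B ∩ nbhd H j) ⟩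
    ∣ A ∩ ⊤ ∣ + deg H B j              ≡⟨ cong (λ X → ∣ X ∣ + deg H B j) (∩-identityʳ A) ⟩
    ∣ A ∣ + deg H B j                  ∎
    where open ≡-Reasoning

  ΔInd-++≤ : ∀ (A : Subset m) (B : Subset k) {b} →
             (∀ {i} → i ∈ A → deg G A i + ∣ B ∣ ≤ b) → (∀ {j} → j ∈ B → ∣ A ∣ + deg H B j ≤ b) →
             ΔInd G∨H (A ++ᵛ B) ≤ b
  ΔInd-++≤ A B {b} ≤b₁ ≤b₂ = ΔInd≤ G∨H (A ++ᵛ B) λ {v} → bySide (joinVertex m k v)
    where
    bySide : ∀ {v} → JoinVertex m k v → v ∈ A ++ᵛ B → deg G∨H (A ++ᵛ B) v ≤ b
    bySide (left i)  i∈ = subst (_≤ b) (sym (deg-↑ˡ A B i)) (≤b₁ ([]=-++⁻ˡ A i∈))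
    bySide (right j) j∈ = subst (_≤ b) (sym (deg-↑ʳ A B j)) (≤b₂ ([]=-++⁻ʳ A j∈))

  deg-↑ˡ≤ΔInd : ∀ {A : Subset m} (B : Subset k) {i} → i ∈ A → deg G A i + ∣ B ∣ ≤ ΔInd G∨H (A ++ᵛ B)
  deg-↑ˡ≤ΔInd {A} B {i} i∈A = subst (_≤ _) (deg-↑ˡ A B i) (deg≤ΔInd G∨H ([]=-++⁺ˡ i∈A))

  deg-↑ʳ≤ΔInd : ∀ (A : Subset m) {B : Subset k} {j} → j ∈ B → ∣ A ∣ + deg H B j ≤ ΔInd G∨H (A ++ᵛ B)
  deg-↑ʳ≤ΔInd A {B} {j} j∈B = subst (_≤ _) (deg-↑ʳ A B j) (deg≤ΔInd G∨H ([]=-++⁺ʳ A j∈B))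

  ΔIndˡ≤ΔInd : ∀ (A : Subset m) (B : Subset k) → ΔInd G A ≤ ΔInd G∨H (A ++ᵛ B)
  ΔIndˡ≤ΔInd A B = ΔInd≤ G A λ i∈A → ≤-trans (m≤m+n _ _) (deg-↑ˡ≤ΔInd B i∈A)

  ΔIndʳ≤ΔInd : ∀ (A : Subset m) (B : Subset k) → ΔInd H B ≤ ΔInd G∨H (A ++ᵛ B)
  ΔIndʳ≤ΔInd A B = ΔInd≤ H B λ j∈B → ≤-trans (m≤n+m _ _) (deg-↑ʳ≤ΔInd A j∈B)

  ΔInd-++⊥≤ΔInd : ∀ (A : Subset m) → ΔInd G∨H (A ++ᵛ ⊥) ≤ ΔInd G A
  ΔInd-++⊥≤ΔInd A = ΔInd-++≤ A ⊥
    (λ {i} i∈A → subst (_≤ ΔInd G A) (sym (trans (cong (deg G A i +_) (∣⊥∣≡0 k)) (+-identityʳ _)))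
                       (deg≤ΔInd G i∈A))
    (λ j∈⊥ → contradiction j∈⊥ ∉⊥)

  ΔInd-++-Independent : ∀ {A : Subset m} {B : Subset k} → Independent G A → Independent H B →
                        ΔInd G∨H (A ++ᵛ B) ≤ ∣ A ∣ ⊔ ∣ B ∣
  ΔInd-++-Independent {A} {B} indA indB = ΔInd-++≤ A B boundˡ boundʳ
    where
    boundˡ : ∀ {i} → i ∈ A → deg G A i + ∣ B ∣ ≤ ∣ A ∣ ⊔ ∣ B ∣
    boundˡ i∈A rewrite Independent⇒deg≡0 G indA i∈A = m≤n⊔m ∣ A ∣ ∣ B ∣
    boundʳ : ∀ {j} → j ∈ B → ∣ A ∣ + deg H B j ≤ ∣ A ∣ ⊔ ∣ B ∣
    boundʳ j∈B rewrite Independent⇒deg≡0 H indB j∈B | +-identityʳ ∣ A ∣ = m≤m⊔n ∣ A ∣ ∣ B ∣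

  Independent-++ : ∀ {A : Subset m} {B : Subset k} → Independent G A → Independent H B →
                   Empty A ⊎ Empty B → Independent G∨H (A ++ᵛ B)
  Independent-++ {A} {B} indA indB oneEmpty {u} {v} = bySide (joinVertex m k u) (joinVertex m k v)
    where
    bothNonempty : ∀ {i j} → i ∈ A → j ∈ B → ¬ (Empty A ⊎ Empty B)
    bothNonempty i∈A _   (inj₁ A≡∅) = A≡∅ (_ , i∈A)
    bothNonempty _   j∈B (inj₂ B≡∅) = B≡∅ (_ , j∈B)
    bySide : ∀ {u v} → JoinVertex m k u → JoinVertex m k v →
             u ∈ A ++ᵛ B → v ∈ A ++ᵛ B → adj G∨H u v ≡ false
    bySide (left i)  (left i')  i∈ i'∈ = trans (adj-↑ˡ-↑ˡ i i') (indA ([]=-++⁻ˡ A i∈) ([]=-++⁻ˡ A i'∈))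
    bySide (right j) (right j') j∈ j'∈ = trans (adj-↑ʳ-↑ʳ j j') (indB ([]=-++⁻ʳ A j∈) ([]=-++⁻ʳ A j'∈))
    bySide (left i)  (right j)  i∈ j∈  = contradiction oneEmpty (bothNonempty ([]=-++⁻ˡ A i∈) ([]=-++⁻ʳ A j∈))
    bySide (right j) (left i)   j∈ i∈  = contradiction oneEmpty (bothNonempty ([]=-++⁻ˡ A i∈) ([]=-++⁻ʳ A j∈))

  Independent-++⁻ : ∀ {A : Subset m} {B : Subset k} → Independent G∨H (A ++ᵛ B) →
                    Independent G A × Independent H B × (Empty A ⊎ Empty B)
  Independent-++⁻ {A} {B} ind =
    (λ u∈A v∈A → trans (sym (adj-↑ˡ-↑ˡ _ _)) (ind ([]=-++⁺ˡ u∈A) ([]=-++⁺ˡ v∈A))) ,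
    (λ u∈B v∈B → trans (sym (adj-↑ʳ-↑ʳ _ _)) (ind ([]=-++⁺ʳ A u∈B) ([]=-++⁺ʳ A v∈B))) ,
    oneEmpty
    where
    oneEmpty : Empty A ⊎ Empty B
    oneEmpty with nonempty? A | nonempty? B
    ... | no A≡∅        | _             = inj₁ A≡∅
    ... | yes _         | no B≡∅        = inj₂ B≡∅
    ... | yes (i , i∈A) | yes (j , j∈B) =
      contradiction (trans (sym (adj-↑ˡ-↑ʳ i j)) (ind ([]=-++⁺ˡ i∈A) ([]=-++⁺ʳ A j∈B))) λ ()

  α-join : α G∨H ≡ α G ⊔ α H
  α-join = ≤-antisym (α≤ G∨H boundBySide) (⊔-lub (α≤ G embedˡ) (α≤ H embedʳ))
    where
    boundBySide : ∀ {S} → Independent G∨H S → ∣ S ∣ ≤ α G ⊔ α H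
    boundBySide {S} ind with Data.Vec.splitAt m S
    ... | A , B , refl with Independent-++⁻ ind
    ...   | _ , indB , inj₁ A≡∅ =
      subst (_≤ α G ⊔ α H) (sym (∣p++q∣≡∣q∣ B A≡∅)) (≤-trans (∣S∣≤α H indB) (m≤n⊔m (α G) (α H)))
    ...   | indA , _ , inj₂ B≡∅ =
      subst (_≤ α G ⊔ α H) (sym (∣p++q∣≡∣p∣ A B≡∅)) (≤-trans (∣S∣≤α G indA) (m≤m⊔n (α G) (α H)))
    embedˡ : ∀ {A} → Independent G A → ∣ A ∣ ≤ α G∨H
    embedˡ {A} indA = subst (_≤ α G∨H) (∣p++q∣≡∣p∣ A (Empty⊥ {k}))
                            (∣S∣≤α G∨H (Independent-++ indA (Independent-⊥ H) (inj₂ Empty⊥)))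
    embedʳ : ∀ {B} → Independent H B → ∣ B ∣ ≤ α G∨H
    embedʳ {B} indB = subst (_≤ α G∨H) (∣p++q∣≡∣q∣ B (Empty⊥ {m}))
                            (∣S∣≤α G∨H (Independent-++ (Independent-⊥ G) indB (inj₁ Empty⊥)))

  Δ≤Δ-join : Δ G ≤ Δ G∨H
  Δ≤Δ-join = maxList-≤ _ (allFin m) λ {i} _ → begin
    ∣ nbhd G i ∣                ≤⟨ m≤m+n _ _ ⟩
    ∣ nbhd G i ∣ + ∣ ⊤ {k} ∣    ≡⟨ sym (∣p++q∣≡∣p∣+∣q∣ (nbhd G i) ⊤) ⟩
    ∣ nbhd G i ++ᵛ ⊤ ∣          ≡⟨ cong ∣_∣ (sym (nbhd-↑ˡ i)) ⟩
    ∣ nbhd G∨H (i ↑ˡ k) ∣       ≤⟨ ≤-maxList (λ v → ∣ nbhd G∨H v ∣) (∈-allFin (i ↑ˡ k)) ⟩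
    Δ G∨H                       ∎
    where open ≤-Reasoning

  ≤σ-join : ∀ {M} → M ≤σ G → M ≤σ H → M ≤ ⌈ suc (α G∨H) /2⌉ → M ≤σ G∨H
  ≤σ-join {M} M≤σG M≤σH M≤⌈α/2⌉ S α<S with Data.Vec.splitAt m S
  ... | A , B , refl with nonempty? A | nonempty? B
  ...   | no A≡∅ | _ = ≤-trans (M≤σH B αH<∣B∣) (ΔIndʳ≤ΔInd A B)
    where
    αH<∣B∣ : α H < ∣ B ∣
    αH<∣B∣ = <-≤-trans (s≤s (m≤n⊔m (α G) (α H))) (subst₂ _<_ α-join (∣p++q∣≡∣q∣ B A≡∅) α<S)
  ...   | yes _ | no B≡∅ = ≤-trans (M≤σG A αG<∣A∣) (ΔIndˡ≤ΔInd A B)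
    where
    αG<∣A∣ : α G < ∣ A ∣
    αG<∣A∣ = <-≤-trans (s≤s (m≤m⊔n (α G) (α H))) (subst₂ _<_ α-join (∣p++q∣≡∣p∣ A B≡∅) α<S)
  ...   | yes (i , i∈A) | yes (j , j∈B) = ≤-trans M≤⌈α/2⌉ (n≤m+m⇒⌈n/2⌉≤m (begin
    suc (α G∨H)         ≤⟨ α<S ⟩
    ∣ A ++ᵛ B ∣         ≡⟨ ∣p++q∣≡∣p∣+∣q∣ A B ⟩
    ∣ A ∣ + ∣ B ∣       ≤⟨ +-mono-≤ (≤-trans (m≤m+n ∣ A ∣ (deg H B j)) (deg-↑ʳ≤ΔInd A j∈B))
                                   (≤-trans (m≤n+m ∣ B ∣ (deg G A i)) (deg-↑ˡ≤ΔInd B i∈A)) ⟩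
    ΔInd G∨H (A ++ᵛ B) + ΔInd G∨H (A ++ᵛ B) ∎))
    where open ≤-Reasoning

  ≤σ-join⇒≤σˡ : ∀ {M} → α H ≤ α G → M ≤σ G∨H → M ≤σ G
  ≤σ-join⇒≤σˡ αH≤αG M≤σG∨H A αG<∣A∣ = ≤-trans (M≤σG∨H (A ++ᵛ ⊥) αG∨H<∣A++⊥∣) (ΔInd-++⊥≤ΔInd A)
    where
    αG∨H<∣A++⊥∣ : α G∨H < ∣ A ++ᵛ ⊥ ∣
    αG∨H<∣A++⊥∣ = subst₂ _<_ (sym (trans α-join (m≥n⇒m⊔n≡m αH≤αG))) (sym (∣p++q∣≡∣p∣ A Empty⊥)) αG<∣A∣

  ≤σ-join⇒≤⊔ : ∀ {M p q} → M ≤σ G∨H → p ≤ α G → q ≤ α H → α G∨H < p + q → M ≤ p ⊔ q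
  ≤σ-join⇒≤⊔ {M} {p} {q} M≤σG∨H p≤αG q≤αH α<p+q with α-attained G | α-attained H
  ... | I , indI , ∣I∣≡αG | J , indJ , ∣J∣≡αH
    with ⊆-ofSize I (subst (p ≤_) (sym ∣I∣≡αG) p≤αG) | ⊆-ofSize J (subst (q ≤_) (sym ∣J∣≡αH) q≤αH)
  ...   | A , A⊆I , ∣A∣≡p | B , B⊆J , ∣B∣≡q =
    ≤-trans (M≤σG∨H (A ++ᵛ B) (subst (α G∨H <_) (sym ∣A++B∣≡p+q) α<p+q))
            (subst₂ (λ a b → ΔInd G∨H (A ++ᵛ B) ≤ a ⊔ b) ∣A∣≡p ∣B∣≡q
                    (ΔInd-++-Independent (⊆-Independent G A⊆I indI) (⊆-Independent H B⊆J indJ)))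
    where
    ∣A++B∣≡p+q : ∣ A ++ᵛ B ∣ ≡ p + q
    ∣A++B∣≡p+q = trans (∣p++q∣≡∣p∣+∣q∣ A B) (cong₂ _+_ ∣A∣≡p ∣B∣≡q)

module _ (G : Graph) where

  α-joinCopies : ∀ k → α (joinCopies G k) ≡ α G
  α-joinCopies zero    = refl
  α-joinCopies (suc k) = begin
    α (G ∨G joinCopies G k)   ≡⟨ α-join G (joinCopies G k) ⟩
    α G ⊔ α (joinCopies G k)  ≡⟨ cong (α G ⊔_) (α-joinCopies k) ⟩
    α G ⊔ α G                 ≡⟨ ⊔-idem (α G) ⟩
    α G                       ∎
    where open ≡-Reasoning

  ≤σ-joinCopies : ∀ {M} → M ≤σ G → M ≤ ⌈ suc (α G) /2⌉ → ∀ k → M ≤σ joinCopies G k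
  ≤σ-joinCopies     M≤σG M≤c zero    = M≤σG
  ≤σ-joinCopies {M} M≤σG M≤c (suc k) =
    ≤σ-join G (joinCopies G k) M≤σG (≤σ-joinCopies M≤σG M≤c k)
            (subst (λ a → M ≤ ⌈ suc a /2⌉) (sym (α-joinCopies (suc k))) M≤c)

  ≤σ-joinCopies⁻ : ∀ {M} → 0 < n G → ∀ k → M ≤σ joinCopies G (suc k) → M ≤σ G × M ≤ ⌈ suc (α G) /2⌉
  ≤σ-joinCopies⁻ {M} 0<n k M≤σJ =
    ≤σ-join⇒≤σˡ G H (≤-reflexive (α-joinCopies k)) M≤σJ ,
    subst (M ≤_) (m≥n⇒m⊔n≡m (⌊n/2⌋≤⌈n/2⌉ (suc a))) (≤σ-join⇒≤⊔ G H M≤σJ ⌈1+a/2⌉≤a ⌊1+a/2⌋≤αH αsplit)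
    where
    H = joinCopies G k
    a = α G
    ⌈1+a/2⌉≤a : ⌈ suc a /2⌉ ≤ a
    ⌈1+a/2⌉≤a = n≤m+m⇒⌈n/2⌉≤m (+-monoˡ-≤ a (1≤α G 0<n))
    ⌊1+a/2⌋≤αH : ⌊ suc a /2⌋ ≤ α H
    ⌊1+a/2⌋≤αH = subst (_ ≤_) (sym (α-joinCopies k)) (≤-trans (⌊n/2⌋≤⌈n/2⌉ (suc a)) ⌈1+a/2⌉≤a)
    αsplit : α (joinCopies G (suc k)) < ⌈ suc a /2⌉ + ⌊ suc a /2⌋
    αsplit = begin-strict
      α (joinCopies G (suc k))    ≡⟨ α-joinCopies (suc k) ⟩
      a                           <⟨ n<1+n a ⟩
      suc a                       ≡⟨ ⌊n/2⌋+⌈n/2⌉≡n (suc a) ⟨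
      ⌊ suc a /2⌋ + ⌈ suc a /2⌉   ≡⟨ +-comm ⌊ suc a /2⌋ _ ⟩
      ⌈ suc a /2⌉ + ⌊ suc a /2⌋   ∎
      where open ≤-Reasoning

  σ-joinCopies : 0 < n G → ∀ k → σ (joinCopies G (suc k)) ≡ min∞ (σ G) (fin ⌈ suc (α G) /2⌉)
  σ-joinCopies 0<n k = ≤∞-ext _ _ λ M → mk⇔
    (λ M≤σJ → let M≤σG , M≤c = ≤σ-joinCopies⁻ 0<n k (to (≤∞σ⇔≤σ J) M≤σJ) in
       from (≤∞-min∞ (σ G) _) (from (≤∞σ⇔≤σ G) M≤σG , M≤c))
    (λ M≤min → let M≤σG , M≤c = to (≤∞-min∞ (σ G) _) M≤min in
       from (≤∞σ⇔≤σ J) (≤σ-joinCopies (to (≤∞σ⇔≤σ G) M≤σG) M≤c (suc k)))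
    where
    J = joinCopies G (suc k)

  ≤∞σ-joinCopies : ∀ {M} → 1 ≤ Δ G → (M + M) ≤∞ σ G → ∀ k → M ≤∞ σ (joinCopies G k)
  ≤∞σ-joinCopies {M} 1≤Δ 2M≤∞σG k = from (≤∞σ⇔≤σ (joinCopies G k)) (≤σ-joinCopies M≤σG M≤c k)
    where
    2M≤σG : (M + M) ≤σ G
    2M≤σG = to (≤∞σ⇔≤σ G) 2M≤∞σG
    M≤σG : M ≤σ G
    M≤σG S α<S = ≤-trans (m≤m+n M M) (2M≤σG S α<S)
    M≤c : M ≤ ⌈ suc (α G) /2⌉
    M≤c = m≤n⇒m≤1+n (m+m≤n⇒m≤⌊n/2⌋ (≤σ⇒≤α G 1≤Δ 2M≤σG))

  ≤∞σ-joinCopies⁻ : ∀ {M} k → M ≤∞ σ (joinCopies G (suc k)) → M ≤∞ σ G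
  ≤∞σ-joinCopies⁻ k M≤∞σJ = from (≤∞σ⇔≤σ G)
    (≤σ-join⇒≤σˡ G (joinCopies G k) (≤-reflexive (α-joinCopies k))
                 (to (≤∞σ⇔≤σ (joinCopies G (suc k))) M≤∞σJ))

module _ (k : ℕ) (F : Family) where

  private
    F∨ : Family
    F∨ m = joinCopies (F m) (suc k)

  ΔToInfinity-joinCopies : ΔToInfinity F → ΔToInfinity F∨
  ΔToInfinity-joinCopies Δ→∞ M =
    let N , M≤Δ = Δ→∞ M in N , λ m N≤m → ≤-trans (M≤Δ m N≤m) (Δ≤Δ-join (F m) (joinCopies (F m) k))

  σToInfinity-joinCopies : ΔToInfinity F → σToInfinity F → σToInfinity F∨
  σToInfinity-joinCopies Δ→∞ σ→∞ M with Δ→∞ 1 | σ→∞ (M + M)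
  ... | N₁ , 1≤Δ | N₂ , 2M≤σ = N₁ ⊔ N₂ , λ m N≤m →
    ≤∞σ-joinCopies (F m) (1≤Δ m (≤-trans (m≤m⊔n N₁ N₂) N≤m))
                         (2M≤σ m (≤-trans (m≤n⊔m N₁ N₂) N≤m)) (suc k)

  σToInfinity-joinCopies⁻ : σToInfinity F∨ → σToInfinity F
  σToInfinity-joinCopies⁻ σ→∞ M =
    let N , M≤σ = σ→∞ M in N , λ m N≤m → ≤∞σ-joinCopies⁻ (F m) k (M≤σ m N≤m)

  Sensitive-joinCopies : Sensitive F → Sensitive F∨
  Sensitive-joinCopies (Δ→∞ , σ→∞) = ΔToInfinity-joinCopies Δ→∞ , σToInfinity-joinCopies Δ→∞ σ→∞

  Insensitive-joinCopies : Insensitive F → Insensitive F∨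
  Insensitive-joinCopies (Δ→∞ , σ↛∞) = ΔToInfinity-joinCopies Δ→∞ , σ↛∞ ∘ σToInfinity-joinCopies⁻

corollary3p3 : ((G : Graph) → 0 < n G → (k : ℕ) →
    σ (joinCopies G (suc k)) ≡ min∞ (σ G) (fin ⌈ suc (α G) /2⌉))
    ×
    ((k : ℕ) → (F : Family) →
    (Sensitive F → Sensitive (λ m → joinCopies (F m) (suc k)))
    × (Insensitive F → Insensitive (λ m → joinCopies (F m) (suc k))))
corollary3p3 = σ-joinCopies , λ k F → Sensitive-joinCopies k F , Insensitive-joinCopies k F
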